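{- Let $P$ be an equational nominal unification problem and let $\langle a_1,\dots,a_n\rangle$ be an ordered list of the distinct atoms occurring in $P$. Then the translation $[P]$ is a higher-order pattern unification problem. Moreover, both the size of $[P]$ and the time needed to compute it are bounded by the square of the size of $P$.
   Context: Nominal setting: sorts of atoms $\nu$, sorts of data $\delta$, sorts $\tau::=\nu\mid\delta\mid\langle\nu\rangle\tau$; atoms, variables (unknowns) $X$ with sorts, function symbols $f:\tau_1\times\cdots\times\tau_n\to\delta$; nominal terms $t::=f(t_1,\dots,t_n)\mid a\mid a.t\mid\pi\cdot X$ with $\pi$ a permutation (finite sequence of swappings of same-sort atoms, acting as a bijection on atoms). A freshness environment is a finite set of constraints $a\#X$. An equational nominal unification problem is a finite set of equations $t\stackrel{?}{\approx}u$ between nominal terms of the same sort. Translation: base types named by the sorts; $[\nu]=\nu$, $[\delta]=\delta$, $[\langle\nu\rangle\tau]=\nu\to[\tau]$, $[\tau_1\times\cdots\times\tau_n\to\tau]=[\tau_1]\to\cdots\to[\tau_n]\to[\tau]$. Atoms $a:\nu$ become $\lambda$-variables $a:\nu$, function symbols $f:\tau$ become constants $f:[\tau]$. For a freshness environment $\nabla$: $[a]_\nabla=a$, $[f(t_1,\dots,t_n)]_\nabla=f([t_1]_\nabla,\dots,[t_n]_\nabla)$, $[a.t]_\nabla=\lambda a.[t]_\nabla$, $[\pi\cdot X]_\nabla=X([\pi\cdot b_1]_\nabla,\dots,[\pi\cdot b_m]_\nabla)$ where $\langle b_1,\dots,b_m\rangle$ is the order-preserving sublist of $\langle a_1,\dots,a_n\rangle$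 of atoms $a$ with $a\#X\notin\nabla$, and $X$ here is the free $\lambda$-variable of type $[\nu_1]\to\cdots\to[\nu_m]\to[\tau]$ ($b_j:\nu_j$, $X:\tau$). For an equational problem, $[P]=\{\lambda a_1.\cdots\lambda a_n.[t]_\emptyset\stackrel{?}{=}\lambda a_1.\cdots\lambda a_n.[u]_\emptyset \mid t\stackrel{?}{\approx}u\in P\}$. A higher-order pattern is a simply typed $\lambda$-term in which, in $\beta\eta$-normal form, every occurrence of a free variable is applied to a list of pairwise distinct bound variables; a higher-order pattern unification problem is a finite set of equations between patterns of the same type. -}

module Defs where

open import Data.Nat using (ℕ; zero; suc; _+_; _<_)
open import Data.Nat.Properties using () renaming (_≟_ to _≟ℕ_)
open import Data.List using (List; []; _∷_; _++_; map; foldr; reverse; length; concatMap)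
open import Data.Nat.ListAction using (sum)
open import Data.Empty using (⊥)
open import Data.Unit using (⊤)
open import Data.List.Relation.Unary.All using (All)
open import Data.List.Relation.Unary.Unique.Propositional using (Unique)
open import Data.Product using (Σ; _×_; _,_; proj₁; proj₂)
open import Data.Maybe using (Maybe; just; nothing)
open import Relation.Binary.PropositionalEquality using (_≡_; refl; cong₂)
open import Relation.Binary.Definitions using (DecidableEquality)
open import Relation.Nullary using (¬_; yes; no)
open import Relation.Nullary.Decidable using (map′)
open import Relation.Binary.Construct.Closure.ReflexiveTransitive using (Star)

data SortOver (A D : Set) : Set where
  atm : A → SortOver A D
  dat : D → SortOver A D
  abs : A → SortOver A D → SortOver A D

-- A nominal signature: sorts of atoms, sorts of data, function symbols
-- f : τ₁ × ⋯ × τₙ → δ.  (Decidable equality of atom sorts is needed to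
-- compute swappings.)
record Signature : Set₁ where
  field
    ASort  : Set
    DSort  : Set
    Fun    : Set
    _≟A_   : DecidableEquality ASort
    arity  : Fun → List (SortOver ASort DSort)
    result : Fun → DSort

module Nominal (S : Signature) where
  open Signature S

  Sort : Set
  Sort = SortOver ASort DSort

  record Atom : Set where
    constructor mkAtom
    field
      sort : ASort
      name : ℕ
  open Atom public

  _≟At_ : DecidableEquality Atom
  mkAtom s n ≟At mkAtom s′ n′ with s ≟A s′ | n ≟ℕ n′
  ... | yes refl | yes refl = yes refl
  ... | no ne    | _        = no λ { refl → ne refl }
  ... | yes _    | no ne    = no λ { refl → ne refl }

  record Unknown : Set where
    constructor mkUnk
    field
      usort : Sort
      uname : ℕ
  open Unknown public

  Swap : Set
  Swap = Atom × Atom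

  Perm : Set
  Perm = List Swap

  swapAtom : Swap → Atom → Atom
  swapAtom (a , b) c with c ≟At a
  ... | yes _ = b
  ... | no _ with c ≟At b
  ...   | yes _ = a
  ...   | no _  = c

  _·_ : Perm → Atom → Atom
  [] · c = c
  (s ∷ π) · c = swapAtom s (π · c)

  PermOK : Perm → Set
  PermOK π = All (λ s → sort (proj₁ s) ≡ sort (proj₂ s)) π

  data NTm : Set where
    fun  : Fun → List NTm → NTm
    atom : Atom → NTm
    abst : Atom → NTm → NTm
    susp : Perm → Unknown → NTm

  mutual
    data HasSort : NTm → Sort → Set where
      atomS : ∀ {a} → HasSort (atom a) (atm (sort a))
      abstS : ∀ {a t τ} → HasSort t τ → HasSort (abst a t) (abs (sort a) τ)
      funS  : ∀ {f ts} → HasSorts ts (arity f) → HasSort (fun f ts) (dat (result f))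
      suspS : ∀ {π X} → PermOK π → HasSort (susp π X) (usort X)

    data HasSorts : List NTm → List Sort → Set where
      []  : HasSorts [] []
      _∷_ : ∀ {t ts τ τs} → HasSort t τ → HasSorts ts τs → HasSorts (t ∷ ts) (τ ∷ τs)

  Problem : Set
  Problem = List (NTm × NTm)

  WellSortedProblem : Problem → Set
  WellSortedProblem P =
    All (λ e → Σ Sort λ τ → HasSort (proj₁ e) τ × HasSort (proj₂ e) τ) P

  mutual
    atomsOf : NTm → List Atom
    atomsOf (fun f ts) = atomsOfs ts
    atomsOf (atom a) = a ∷ []
    atomsOf (abst a t) = a ∷ atomsOf t
    atomsOf (susp π X) = concatMap (λ s → proj₁ s ∷ proj₂ s ∷ []) π

    atomsOfs : List NTm → List Atom
    atomsOfs [] = []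
    atomsOfs (t ∷ ts) = atomsOf t ++ atomsOfs ts

  atomsP : Problem → List Atom
  atomsP P = concatMap (λ e → atomsOf (proj₁ e) ++ atomsOf (proj₂ e)) P

  mutual
    nsize : NTm → ℕ
    nsize (fun f ts) = suc (nsizes ts)
    nsize (atom a) = 1
    nsize (abst a t) = suc (suc (nsize t))
    nsize (susp π X) = suc (length π)

    nsizes : List NTm → ℕ
    nsizes [] = 0
    nsizes (t ∷ ts) = nsize t + nsizes ts

  psize : Problem → ℕ
  psize P = sum (map (λ e → nsize (proj₁ e) + nsize (proj₂ e)) P)

  -- Base types are the sorts; bound variables
  -- are de Bruijn indices (λ-terms up to α), free variables are the
  -- unknowns X, each carrying its (simple) type; constants are the
  -- function symbols.

  infixr 5 _⇒_
  data Ty : Set where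
    ν   : ASort → Ty
    δ   : DSort → Ty
    _⇒_ : Ty → Ty → Ty

  data Tm : Set where
    bv  : ℕ → Tm
    fv  : Unknown → Ty → Tm
    con : Fun → Tm
    app : Tm → Tm → Tm
    lam : Ty → Tm → Tm

  ⟦_⟧s : Sort → Ty
  ⟦ atm a ⟧s = ν a
  ⟦ dat d ⟧s = δ d
  ⟦ abs a τ ⟧s = ν a ⇒ ⟦ τ ⟧s

  funTy : Fun → Ty
  funTy f = foldr (λ τ T → ⟦ τ ⟧s ⇒ T) (δ (result f)) (arity f)

  data _∋_∶_ : List Ty → ℕ → Ty → Set where
    here  : ∀ {Γ T} → (T ∷ Γ) ∋ zero ∶ T
    there : ∀ {Γ T U i} → Γ ∋ i ∶ T → (U ∷ Γ) ∋ suc i ∶ T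

  data _⊢_∶_ : List Ty → Tm → Ty → Set where
    bvT  : ∀ {Γ i T} → Γ ∋ i ∶ T → Γ ⊢ bv i ∶ T
    fvT  : ∀ {Γ X T} → Γ ⊢ fv X T ∶ T
    conT : ∀ {Γ f} → Γ ⊢ con f ∶ funTy f
    appT : ∀ {Γ t u T U} → Γ ⊢ t ∶ (T ⇒ U) → Γ ⊢ u ∶ T → Γ ⊢ app t u ∶ U
    lamT : ∀ {Γ t T U} → (T ∷ Γ) ⊢ t ∶ U → Γ ⊢ lam T t ∶ (T ⇒ U)

  ext : (ℕ → ℕ) → ℕ → ℕ
  ext ρ zero = zero
  ext ρ (suc n) = suc (ρ n)

  rename : (ℕ → ℕ) → Tm → Tm
  rename ρ (bv i) = bv (ρ i)
  rename ρ (fv X T) = fv X T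
  rename ρ (con f) = con f
  rename ρ (app t u) = app (rename ρ t) (rename ρ u)
  rename ρ (lam T t) = lam T (rename (ext ρ) t)

  exts : (ℕ → Tm) → ℕ → Tm
  exts σ zero = bv zero
  exts σ (suc n) = rename suc (σ n)

  subst : (ℕ → Tm) → Tm → Tm
  subst σ (bv i) = σ i
  subst σ (fv X T) = fv X T
  subst σ (con f) = con f
  subst σ (app t u) = app (subst σ t) (subst σ u)
  subst σ (lam T t) = lam T (subst (exts σ) t)

  sub0 : Tm → ℕ → Tm
  sub0 u zero = u
  sub0 u (suc n) = bv n

  data _⟶_ : Tm → Tm → Set where
    β    : ∀ {T t u} → app (lam T t) u ⟶ subst (sub0 u) t
    η    : ∀ {T t} → lam T (app (rename suc t) (bv zero)) ⟶ t
    appl : ∀ {t t′ u} → t ⟶ t′ → app t u ⟶ app t′ u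
    appr : ∀ {t u u′} → u ⟶ u′ → app t u ⟶ app t u′
    lamc : ∀ {T t t′} → t ⟶ t′ → lam T t ⟶ lam T t′

  _⟶*_ : Tm → Tm → Set
  _⟶*_ = Star _⟶_

  βηNormal : Tm → Set
  βηNormal t = ∀ t′ → ¬ (t ⟶ t′)

  apps : Tm → List Tm → Tm
  apps h [] = h
  apps h (u ∷ us) = apps (app h u) us

  IsFlexHead : Tm → Set
  IsFlexHead (fv X T) = ⊤
  IsFlexHead (app t u) = IsFlexHead t
  IsFlexHead _ = ⊥

  data PatCond (k : ℕ) : Tm → Set where
    lamP  : ∀ {T t} → PatCond (suc k) t → PatCond k (lam T t)
    bvP   : ∀ {i} → PatCond k (bv i)
    conP  : ∀ {f} → PatCond k (con f)
    appP  : ∀ {t u} → ¬ IsFlexHead t → PatCond k t → PatCond k u → PatCond k (app t u)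
    flexP : ∀ {X T} (is : List ℕ) → All (_< k) is → Unique is →
            PatCond k (apps (fv X T) (map bv is))

  IsPattern : Tm → Set
  IsPattern t = Σ Tm λ n → (t ⟶* n) × βηNormal n × PatCond zero n

  HOPatternProblem : List (Tm × Tm) → Set
  HOPatternProblem Q =
    All (λ e → Σ Ty λ T → ([] ⊢ proj₁ e ∶ T) × ([] ⊢ proj₂ e ∶ T)
                         × IsPattern (proj₁ e) × IsPattern (proj₂ e)) Q

  tsize : Tm → ℕ
  tsize (bv i) = 1
  tsize (fv X T) = 1
  tsize (con f) = 1
  tsize (app t u) = suc (tsize t + tsize u)
  tsize (lam T t) = suc (tsize t)

  qsize : List (Tm × Tm) → ℕ
  qsize Q = sum (map (λ e → tsize (proj₁ e) + tsize (proj₂ e)) Q)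

  -- The translation [·]_∅ (with empty freshness environment, so every
  -- atom of ⟨a₁,…,aₙ⟩ is kept as an argument of each unknown).

  idx : List Atom → Atom → ℕ
  idx [] a = zero
  idx (b ∷ sc) a with a ≟At b
  ... | yes _ = zero
  ... | no _  = suc (idx sc a)

  lams : List Atom → Tm → Tm
  lams as body = foldr (λ a b → lam (ν (sort a)) b) body as

  typeX : List Atom → Unknown → Ty
  typeX as X = foldr (λ b T → ν (sort b) ⇒ T) ⟦ usort X ⟧s as

  -- as = ⟨a₁,…,aₙ⟩, sc = atoms bound so far (innermost first)
  mutual
    tr : List Atom → List Atom → NTm → Tm
    tr as sc (fun f ts) = apps (con f) (trs as sc ts)
    tr as sc (atom a) = bv (idx sc a)
    tr as sc (abst a t) = lam (ν (sort a)) (tr as (a ∷ sc) t)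
    tr as sc (susp π X) = apps (fv X (typeX as X)) (map (λ b → bv (idx sc (π · b))) as)

    trs : List Atom → List Atom → List NTm → List Tm
    trs as sc [] = []
    trs as sc (t ∷ ts) = tr as sc t ∷ trs as sc ts

  trTop : List Atom → NTm → Tm
  trTop as t = lams as (tr as (reverse as) t)

  ⟦_⟧P : Problem → List Atom → List (Tm × Tm)
  ⟦ P ⟧P as = map (λ e → trTop as (proj₁ e) , trTop as (proj₂ e)) P

  -- The same translation as an algorithm instrumented with a step
  -- counter (unit cost per elementary step: one tick per swapping
  -- applied, per output node built, per list cell traversed; the lookup
  -- of a bound atom's binder is a unit-cost RAM lookup).

  permC : Perm → Atom → Atom × ℕ
  permC [] c = c , 1
  permC (s ∷ π) c with permC π c
  ... | d , k = swapAtom s d , suc k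

  argsC : List Atom → Perm → List Atom → List Tm × ℕ
  argsC sc π [] = [] , 1
  argsC sc π (b ∷ bs) with permC π b | argsC sc π bs
  ... | c , k | us , k′ = bv (idx sc c) ∷ us , suc (k + k′)

  typeXC : List Atom → Unknown → Ty × ℕ
  typeXC as X = typeX as X , suc (length as)

  mutual
    trC : List Atom → List Atom → NTm → Tm × ℕ
    trC as sc (fun f ts) with trsC as sc ts
    ... | us , k = apps (con f) us , suc k
    trC as sc (atom a) = bv (idx sc a) , 1
    trC as sc (abst a t) with trC as (a ∷ sc) t
    ... | u , k = lam (ν (sort a)) u , suc k
    trC as sc (susp π X) with typeXC as X | argsC sc π as
    ... | T , k | us , k′ = apps (fv X T) us , suc (k + k′)

    trsC : List Atom → List Atom → List NTm → List Tm × ℕ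
    trsC as sc [] = [] , 1
    trsC as sc (t ∷ ts) with trC as sc t | trsC as sc ts
    ... | u , k | us , k′ = u ∷ us , suc (k + k′)

  lamsC : List Atom → Tm → Tm × ℕ
  lamsC as body = lams as body , suc (length as)

  reverseC : List Atom → List Atom × ℕ
  reverseC as = reverse as , suc (length as)

  eqsC : List Atom → List Atom → Problem → List (Tm × Tm) × ℕ
  eqsC as sc [] = [] , 1
  eqsC as sc (e ∷ P) with trC as sc (proj₁ e) | trC as sc (proj₂ e) | eqsC as sc P
  ... | l , k₁ | r , k₂ | Q , k₃ with lamsC as l | lamsC as r
  ...   | l′ , k₄ | r′ , k₅ = (l′ , r′) ∷ Q , suc (k₁ + k₂ + k₃ + k₄ + k₅)

  translateC : Problem → List Atom → List (Tm × Tm) × ℕ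
  translateC P as with reverseC as
  ... | sc , k with eqsC as sc P
  ...   | Q , k′ = Q , k + k′

-- Every translated term is built from constants applied to translated terms,
-- bound atoms, abstractions, and unknowns X applied to the bound variables
-- π·a₁, …, π·aₙ; these are in scope because all aᵢ are bound at the top,
-- and pairwise distinct because the aᵢ are and π is a bijection.  Such
-- pattern-shaped terms contain no β-redex, and η-contracting them from the
-- inside out preserves the pattern shape, so their βη-normal forms are
-- patterns.  For the bounds, the instrumented translation spends at most
-- 5(n+1)·|t| steps on a term t, where n is the number of atoms, and builds
-- no more nodes than it spends steps; as the aᵢ are distinct atoms of P,
-- n ≤ 2|P|.

module Submission where

open import Defs
open import Data.Nat using (ℕ; zero; suc; _+_; _*_; _≤_; _<_; z≤n; s≤s)
open import Data.Nat.Properties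
  using (suc-injective; ≤-trans; ≤-reflexive; +-suc; +-identityʳ; +-mono-≤; +-monoˡ-≤; +-monoʳ-≤;
         *-monoˡ-≤; *-monoʳ-≤; *-distribˡ-+; n≤1+n; m≤m+n; m≤m*n; m≤n+m; module ≤-Reasoning)
open import Data.Nat.Tactic.RingSolver using (solve-∀)
open import Data.List
  using (List; []; _∷_; _++_; _∷ʳ_; map; foldr; length; reverse; concatMap; initLast; _∷ʳ′_)
import Data.List.Properties as List
open import Data.List.Relation.Unary.All using (All; []; _∷_)
import Data.List.Relation.Unary.All as All
import Data.List.Relation.Unary.All.Properties as All
open import Data.List.Relation.Unary.Any using (here; there)
import Data.List.Relation.Unary.Any.Properties as Any
open import Data.List.Relation.Unary.AllPairs using ([]; _∷_)
open import Data.List.Relation.Unary.Unique.Propositional using (Unique)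
import Data.List.Relation.Unary.Unique.Propositional.Properties as Unique
open import Data.List.Relation.Binary.Pointwise using (Pointwise; []; _∷_)
open import Data.List.Membership.Propositional using (_∈_)
open import Data.List.Membership.Propositional.Properties using (∈-++⁺ˡ; ∈-++⁺ʳ; ∈-++⁻; ∈-∃++)
open import Data.List.Relation.Binary.Subset.Propositional using (_⊆_)
open import Data.Product using (Σ; ∃-syntax; _×_; _,_; proj₁; proj₂)
open import Data.Sum using (_⊎_; inj₁; inj₂)
open import Data.Empty using (⊥; ⊥-elim)
open import Data.Unit using (⊤; tt)
open import Function.Base using (_∘_)
open import Function.Bundles using (_⇔_; Equivalence)
open import Relation.Nullary using (¬_; yes; no)
open import Relation.Binary.PropositionalEquality
open import Relation.Binary.Construct.Closure.ReflexiveTransitive using (ε; _◅_; _◅◅_; gmap)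

m+d≡n⇒m≤n : ∀ {m n} d → m + d ≡ n → m ≤ n
m+d≡n⇒m≤n {m} d eq = ≤-trans (m≤m+n m d) (≤-reflexive eq)

Unique-++⁻ˡ : ∀ {A : Set} (xs : List A) {ys} → Unique (xs ++ ys) → Unique xs
Unique-++⁻ˡ [] _ = []
Unique-++⁻ˡ (x ∷ xs) (x∉ ∷ u) = All.++⁻ˡ xs x∉ ∷ Unique-++⁻ˡ xs u

Unique-map⁺-on : ∀ {A B : Set} (f : A → B) {xs} →
                 (∀ {x y} → x ∈ xs → y ∈ xs → f x ≡ f y → x ≡ y) →
                 Unique xs → Unique (map f xs)
Unique-map⁺-on f inj [] = []
Unique-map⁺-on f inj (x∉ ∷ u) =
  All.map⁺ (All.tabulate λ y∈ fx≡fy → All.lookup x∉ y∈ (inj (here refl) (there y∈) fx≡fy))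
  ∷ Unique-map⁺-on f (λ x∈ y∈ → inj (there x∈) (there y∈)) u

Unique-⊆⇒length-≤ : ∀ {A : Set} {xs ys : List A} → Unique xs → xs ⊆ ys → length xs ≤ length ys
Unique-⊆⇒length-≤ {xs = []} _ _ = z≤n
Unique-⊆⇒length-≤ {xs = x ∷ xs} (x∉ ∷ u) xs⊆ys with ∈-∃++ (xs⊆ys (here refl))
... | ys₁ , ys₂ , refl = begin
  suc (length xs)               ≤⟨ s≤s (Unique-⊆⇒length-≤ u xs⊆ys₁++ys₂) ⟩
  suc (length (ys₁ ++ ys₂))     ≡⟨ cong suc (List.length-++ ys₁) ⟩
  suc (length ys₁ + length ys₂) ≡⟨ sym (+-suc (length ys₁) (length ys₂)) ⟩
  length ys₁ + length (x ∷ ys₂) ≡⟨ sym (List.length-++ ys₁) ⟩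
  length (ys₁ ++ x ∷ ys₂)       ∎
  where
  open ≤-Reasoning
  xs⊆ys₁++ys₂ : xs ⊆ ys₁ ++ ys₂
  xs⊆ys₁++ys₂ y∈ with ∈-++⁻ ys₁ (xs⊆ys (there y∈))
  ... | inj₁ y∈ys₁         = ∈-++⁺ˡ y∈ys₁
  ... | inj₂ (here refl)   = ⊥-elim (All.lookup x∉ y∈ refl)
  ... | inj₂ (there y∈ys₂) = ∈-++⁺ʳ ys₁ y∈ys₂

n≤n*n+1 : ∀ n → n ≤ n * n + 1
n≤n*n+1 zero        = z≤n
n≤n*n+1 n@(suc _) = ≤-trans (m≤m*n n n) (m≤m+n (n * n) 1)

quadratic-bound : ∀ {m n x} → m ≤ 2 * n → x ≤ suc m + suc (5 * suc m * n) → x ≤ 20 * (n * n) + 20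
quadratic-bound {m} {n} {x} m≤2n x≤ = begin
  x
    ≤⟨ x≤ ⟩
  suc m + suc (5 * suc m * n)
    ≤⟨ +-mono-≤ (s≤s m≤2n) (s≤s (*-monoˡ-≤ n (*-monoʳ-≤ 5 (s≤s m≤2n)))) ⟩
  suc (2 * n) + suc (5 * suc (2 * n) * n)
    ≡⟨ lem₁ n ⟩
  10 * (n * n) + 2 + 7 * n
    ≤⟨ +-monoʳ-≤ (10 * (n * n) + 2) (*-monoʳ-≤ 7 (n≤n*n+1 n)) ⟩
  10 * (n * n) + 2 + 7 * (n * n + 1)
    ≤⟨ m+d≡n⇒m≤n (3 * (n * n) + 11) (lem₂ n) ⟩
  20 * (n * n) + 20
    ∎
  where
  open ≤-Reasoning
  lem₁ : ∀ n → suc (2 * n) + suc (5 * suc (2 * n) * n) ≡ 10 * (n * n) + 2 + 7 * n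
  lem₁ = solve-∀
  lem₂ : ∀ n → 10 * (n * n) + 2 + 7 * (n * n + 1) + (3 * (n * n) + 11) ≡ 20 * (n * n) + 20
  lem₂ = solve-∀

module Translation (S : Signature) where
  open Signature S
  open Nominal S hiding (subst)

  thin : ℕ → ℕ → ℕ
  thin zero    = suc
  thin (suc k) = ext (thin k)

  Occurs : ℕ → Tm → Set
  Occurs j (bv i)    = i ≡ j
  Occurs j (fv X T)  = ⊥
  Occurs j (con f)   = ⊥
  Occurs j (app t u) = Occurs j t ⊎ Occurs j u
  Occurs j (lam T t) = Occurs (suc j) t

  thin-≢ : ∀ k i → thin k i ≢ k
  thin-≢ (suc k) (suc i) eq = thin-≢ k i (suc-injective eq)

  ¬Occurs-thin : ∀ k t → ¬ Occurs k (rename (thin k) t)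
  ¬Occurs-thin k (bv i) o           = thin-≢ k i o
  ¬Occurs-thin k (app t u) (inj₁ o) = ¬Occurs-thin k t o
  ¬Occurs-thin k (app t u) (inj₂ o) = ¬Occurs-thin k u o
  ¬Occurs-thin k (lam T t) o        = ¬Occurs-thin (suc k) t o

  Occurs-rename⁻ : ∀ ρ {j} t → Occurs j (rename ρ t) → ∃[ i ] Occurs i t × ρ i ≡ j
  Occurs-rename⁻ ρ (bv i) o = i , refl , o
  Occurs-rename⁻ ρ (app t u) (inj₁ o) with Occurs-rename⁻ ρ t o
  ... | i , oi , e = i , inj₁ oi , e
  Occurs-rename⁻ ρ (app t u) (inj₂ o) with Occurs-rename⁻ ρ u o
  ... | i , oi , e = i , inj₂ oi , e
  Occurs-rename⁻ ρ (lam T t) o with Occurs-rename⁻ (ext ρ) t o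
  ... | suc i , oi , e = i , oi , suc-injective e

  Occurs₀-rename-ext⁻ : ∀ ρ t → Occurs 0 (rename (ext ρ) t) → Occurs 0 t
  Occurs₀-rename-ext⁻ ρ t o with Occurs-rename⁻ (ext ρ) t o
  ... | zero , oi , _ = oi

  Occurs-apps-head : ∀ {k h} us → Occurs k h → Occurs k (apps h us)
  Occurs-apps-head []       o = o
  Occurs-apps-head (u ∷ us) o = Occurs-apps-head us (inj₁ o)

  rename-apps : ∀ ρ h us → rename ρ (apps h us) ≡ apps (rename ρ h) (map (rename ρ) us)
  rename-apps ρ h []       = refl
  rename-apps ρ h (u ∷ us) = rename-apps ρ (app h u) us

  apps-∷ʳ : ∀ h us u → apps h (us ∷ʳ u) ≡ app (apps h us) u
  apps-∷ʳ h []       u = refl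
  apps-∷ʳ h (v ∷ us) u = apps-∷ʳ (app h v) us u

  apps-≢-bv : ∀ {h j} us → (∀ {i} → h ≢ bv i) → apps h us ≢ bv j
  apps-≢-bv []       h≢ = h≢
  apps-≢-bv (u ∷ us) h≢ = apps-≢-bv us λ ()

  app-injective : ∀ {t t′ u u′} → app t u ≡ app t′ u′ → t ≡ t′ × u ≡ u′
  app-injective refl = refl , refl

  -- Terms of pattern shape: heads are constants or free variables, never
  -- abstractions (so there is no β-redex), and free variables are applied
  -- to bound variables only.

  data PTm : Set where
    plam : Ty → PTm → PTm
    pcon : Fun → List PTm → PTm
    pbv  : ℕ → PTm
    pfv  : Unknown → Ty → List ℕ → PTm

  mutual
    embed : PTm → Tm
    embed (plam T p)   = lam T (embed p)
    embed (pcon f ps)  = apps (con f) (embeds ps)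
    embed (pbv i)      = bv i
    embed (pfv X T is) = apps (fv X T) (map bv is)

    embeds : List PTm → List Tm
    embeds []       = []
    embeds (p ∷ ps) = embed p ∷ embeds ps

  embed-pcon-∷ʳ : ∀ f ps p → embed (pcon f (ps ∷ʳ p)) ≡ app (embed (pcon f ps)) (embed p)
  embed-pcon-∷ʳ f ps p =
    trans (cong (apps (con f)) (embeds-∷ʳ ps)) (apps-∷ʳ (con f) (embeds ps) (embed p))
    where
    embeds-∷ʳ : ∀ ps → embeds (ps ∷ʳ p) ≡ embeds ps ∷ʳ embed p
    embeds-∷ʳ []       = refl
    embeds-∷ʳ (q ∷ ps) = cong (embed q ∷_) (embeds-∷ʳ ps)

  embed-pfv-∷ʳ : ∀ X T is i → embed (pfv X T (is ∷ʳ i)) ≡ app (embed (pfv X T is)) (bv i)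
  embed-pfv-∷ʳ X T is i =
    trans (cong (apps (fv X T)) (List.map-++ bv is (i ∷ []))) (apps-∷ʳ (fv X T) (map bv is) (bv i))

  mutual
    thinP : ℕ → PTm → PTm
    thinP k (plam T p)   = plam T (thinP (suc k) p)
    thinP k (pcon f ps)  = pcon f (thinPs k ps)
    thinP k (pbv i)      = pbv (thin k i)
    thinP k (pfv X T is) = pfv X T (map (thin k) is)

    thinPs : ℕ → List PTm → List PTm
    thinPs k []       = []
    thinPs k (p ∷ ps) = thinP k p ∷ thinPs k ps

  mutual
    embed-thinP : ∀ k p → embed (thinP k p) ≡ rename (thin k) (embed p)
    embed-thinP k (plam T p)   = cong (lam T) (embed-thinP (suc k) p)
    embed-thinP k (pcon f ps)  =
      trans (cong (apps (con f)) (embeds-thinPs k ps)) (sym (rename-apps (thin k) (con f) (embeds ps)))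
    embed-thinP k (pbv i)      = refl
    embed-thinP k (pfv X T is) =
      trans (cong (apps (fv X T)) (trans (sym (List.map-∘ is)) (List.map-∘ is)))
            (sym (rename-apps (thin k) (fv X T) (map bv is)))

    embeds-thinPs : ∀ k ps → embeds (thinPs k ps) ≡ map (rename (thin k)) (embeds ps)
    embeds-thinPs k []       = refl
    embeds-thinPs k (p ∷ ps) = cong₂ _∷_ (embed-thinP k p) (embeds-thinPs k ps)

  data StrengthenVar (k i : ℕ) : Set where
    thinned : ∀ j → i ≡ thin k j → StrengthenVar k i
    occurs  : i ≡ k → StrengthenVar k i

  strengthenVar : ∀ k i → StrengthenVar k i
  strengthenVar zero    zero    = occurs refl
  strengthenVar zero    (suc i) = thinned i refl
  strengthenVar (suc k) zero    = thinned zero refl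
  strengthenVar (suc k) (suc i) with strengthenVar k i
  ... | thinned j e = thinned (suc j) (cong suc e)
  ... | occurs e    = occurs (cong suc e)

  data StrengthenVars (k : ℕ) (is : List ℕ) : Set where
    thinned : ∀ js → is ≡ map (thin k) js → StrengthenVars k is
    occurs  : (∀ h → Occurs k (apps h (map bv is))) → StrengthenVars k is

  strengthenVars : ∀ k is → StrengthenVars k is
  strengthenVars k []       = thinned [] refl
  strengthenVars k (i ∷ is) with strengthenVar k i | strengthenVars k is
  ... | occurs e    | _              = occurs λ h → Occurs-apps-head (map bv is) (inj₂ e)
  ... | thinned j e | occurs o       = occurs λ h → o (app h (bv i))
  ... | thinned j e | thinned js es  = thinned (j ∷ js) (cong₂ _∷_ e es)

  data Strengthen (k : ℕ) (p : PTm) : Set where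
    thinned : ∀ r → p ≡ thinP k r → Strengthen k p
    occurs  : Occurs k (embed p) → Strengthen k p

  data Strengthens (k : ℕ) (ps : List PTm) : Set where
    thinned : ∀ rs → ps ≡ thinPs k rs → Strengthens k ps
    occurs  : (∀ h → Occurs k (apps h (embeds ps))) → Strengthens k ps

  mutual
    strengthen : ∀ k p → Strengthen k p
    strengthen k (plam T p) with strengthen (suc k) p
    ... | thinned r e = thinned (plam T r) (cong (plam T) e)
    ... | occurs o    = occurs o
    strengthen k (pcon f ps) with strengthens k ps
    ... | thinned rs e = thinned (pcon f rs) (cong (pcon f) e)
    ... | occurs o     = occurs (o (con f))
    strengthen k (pbv i) with strengthenVar k i
    ... | thinned j e = thinned (pbv j) (cong pbv e)
    ... | occurs e    = occurs e
    strengthen k (pfv X T is) with strengthenVars k is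
    ... | thinned js e = thinned (pfv X T js) (cong (pfv X T) e)
    ... | occurs o     = occurs (o (fv X T))

    strengthens : ∀ k ps → Strengthens k ps
    strengthens k []       = thinned [] refl
    strengthens k (p ∷ ps) with strengthen k p | strengthens k ps
    ... | occurs o    | _             = occurs λ h → Occurs-apps-head (embeds ps) (inj₂ o)
    ... | thinned r e | occurs o      = occurs λ h → o (app h (embed p))
    ... | thinned r e | thinned rs es = thinned (r ∷ rs) (cong₂ _∷_ e es)

  NoEtaRedexBody : Tm → Set
  NoEtaRedexBody t = ∀ s → t ≡ app s (bv 0) → Occurs 0 s

  data Nf : PTm → Set where
    plam : ∀ {T p} → Nf p → NoEtaRedexBody (embed p) → Nf (plam T p)
    pcon : ∀ {f ps} → All Nf ps → Nf (pcon f ps)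
    pbv  : ∀ {i} → Nf (pbv i)
    pfv  : ∀ {X T is} → Nf (pfv X T is)

  data Wf : ℕ → PTm → Set where
    plam : ∀ {k T p} → Wf (suc k) p → Wf k (plam T p)
    pcon : ∀ {k f ps} → All (Wf k) ps → Wf k (pcon f ps)
    pbv  : ∀ {k i} → Wf k (pbv i)
    pfv  : ∀ {k X T is} → All (_< k) is → Unique is → Wf k (pfv X T is)

  mutual
    Nf-thinP⁻ : ∀ j r → Nf (thinP j r) → Nf r
    Nf-thinP⁻ j (plam T r) (plam nf ¬η) = plam (Nf-thinP⁻ (suc j) r nf) λ s e →
      Occurs₀-rename-ext⁻ (thin j) s
        (¬η (rename (thin (suc j)) s) (trans (embed-thinP (suc j) r) (cong (rename (thin (suc j))) e)))
    Nf-thinP⁻ j (pcon f rs)  (pcon nfs) = pcon (Nfs-thinPs⁻ j rs nfs)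
    Nf-thinP⁻ j (pbv i)      pbv        = pbv
    Nf-thinP⁻ j (pfv X T is) pfv        = pfv

    Nfs-thinPs⁻ : ∀ j rs → All Nf (thinPs j rs) → All Nf rs
    Nfs-thinPs⁻ j []       []         = []
    Nfs-thinPs⁻ j (r ∷ rs) (nf ∷ nfs) = Nf-thinP⁻ j r nf ∷ Nfs-thinPs⁻ j rs nfs

  thin-<⁻ : ∀ j i {k} → j ≤ k → thin j i < suc k → i < k
  thin-<⁻ zero    i       _         (s≤s i<k)  = i<k
  thin-<⁻ (suc j) zero    {suc k} _ _          = s≤s z≤n
  thin-<⁻ (suc j) (suc i) (s≤s j≤k) (s≤s lt) = s≤s (thin-<⁻ j i j≤k lt)

  mutual
    Wf-thinP⁻ : ∀ j {k} r → j ≤ k → Wf (suc k) (thinP j r) → Wf k r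
    Wf-thinP⁻ j (plam T r)   j≤k (plam wf)  = plam (Wf-thinP⁻ (suc j) r (s≤s j≤k) wf)
    Wf-thinP⁻ j (pcon f rs)  j≤k (pcon wfs) = pcon (Wfs-thinPs⁻ j rs j≤k wfs)
    Wf-thinP⁻ j (pbv i)      j≤k pbv        = pbv
    Wf-thinP⁻ j (pfv X T is) j≤k (pfv is< u) =
      pfv (All.map (thin-<⁻ j _ j≤k) (All.map⁻ is<)) (Unique.map⁻ u)

    Wfs-thinPs⁻ : ∀ j {k} rs → j ≤ k → All (Wf (suc k)) (thinPs j rs) → All (Wf k) rs
    Wfs-thinPs⁻ j []       j≤k []         = []
    Wfs-thinPs⁻ j (r ∷ rs) j≤k (wf ∷ wfs) = Wf-thinP⁻ j r j≤k wf ∷ Wfs-thinPs⁻ j rs j≤k wfs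

  data EtaView (q : PTm) : Set where
    redex   : ∀ r → embed q ≡ app (rename suc (embed r)) (bv 0) →
              (∀ {k} → Wf (suc k) q → Wf k r) → (Nf q → Nf r) → EtaView q
    noRedex : NoEtaRedexBody (embed q) → EtaView q

  redex-embed : ∀ {t q₀ r} → t ≡ app (embed q₀) (bv 0) → q₀ ≡ thinP 0 r →
                t ≡ app (rename suc (embed r)) (bv 0)
  redex-embed {r = r} e refl = trans e (cong (λ s → app s (bv 0)) (embed-thinP 0 r))

  noRedex-last : ∀ {t s u} → t ≡ app s u → u ≢ bv 0 → NoEtaRedexBody t
  noRedex-last e u≢ s′ e′ = ⊥-elim (u≢ (proj₂ (app-injective (trans (sym e) e′))))

  noRedex-occurs : ∀ {t s} → t ≡ app s (bv 0) → Occurs 0 s → NoEtaRedexBody t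
  noRedex-occurs e o s′ e′ = subst (Occurs 0) (proj₁ (app-injective (trans (sym e) e′))) o

  data LastArg : PTm → Set where
    bv₀   : LastArg (pbv 0)
    other : ∀ {p} → embed p ≢ bv 0 → LastArg p

  lastArg : ∀ p → LastArg p
  lastArg (plam T p)    = other λ ()
  lastArg (pcon f ps)   = other (apps-≢-bv (embeds ps) λ ())
  lastArg (pbv zero)    = bv₀
  lastArg (pbv (suc i)) = other λ ()
  lastArg (pfv X T is)  = other (apps-≢-bv (map bv is) λ ())

  -- λ T. q is an η-redex iff the last argument of q is bv 0 and the rest
  -- of q can be strengthened at 0.
  etaView : ∀ q → EtaView q
  etaView (plam T p) = noRedex λ _ ()
  etaView (pbv i)    = noRedex λ _ ()
  etaView (pcon f ps) with initLast ps
  ... | [] = noRedex λ _ ()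
  ... | ps₀ ∷ʳ′ p with lastArg p
  ...   | other p≢ = noRedex (noRedex-last (embed-pcon-∷ʳ f ps₀ p) p≢)
  ...   | bv₀ with strengthen 0 (pcon f ps₀)
  ...     | occurs o    = noRedex (noRedex-occurs (embed-pcon-∷ʳ f ps₀ (pbv 0)) o)
  ...     | thinned r e = redex r (redex-embed (embed-pcon-∷ʳ f ps₀ (pbv 0)) e)
    (λ { (pcon wfs) → Wf-thinP⁻ 0 r z≤n (subst (Wf _) e (pcon (All.++⁻ˡ ps₀ wfs))) })
    (λ { (pcon nfs) → Nf-thinP⁻ 0 r (subst Nf e (pcon (All.++⁻ˡ ps₀ nfs))) })
  etaView (pfv X T is) with initLast is
  ... | [] = noRedex λ _ ()
  ... | is₀ ∷ʳ′ suc i = noRedex (noRedex-last (embed-pfv-∷ʳ X T is₀ (suc i)) λ ())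
  ... | is₀ ∷ʳ′ zero with strengthenVars 0 is₀
  ...   | occurs o     = noRedex (noRedex-occurs (embed-pfv-∷ʳ X T is₀ 0) (o (fv X T)))
  ...   | thinned js e =
    redex (pfv X T js) (redex-embed (embed-pfv-∷ʳ X T is₀ 0) (cong (pfv X T) e))
    (λ { (pfv is< u) → Wf-thinP⁻ 0 (pfv X T js) z≤n
           (subst (Wf _) (cong (pfv X T) e) (pfv (All.++⁻ˡ is₀ is<) (Unique-++⁻ˡ is₀ u))) })
    (λ _ → pfv)

  ηlam : Ty → PTm → PTm
  ηlam T q with etaView q
  ... | redex r _ _ _ = r
  ... | noRedex _     = plam T q

  mutual
    ηnf : PTm → PTm
    ηnf (plam T p)   = ηlam T (ηnf p)
    ηnf (pcon f ps)  = pcon f (ηnfs ps)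
    ηnf (pbv i)      = pbv i
    ηnf (pfv X T is) = pfv X T is

    ηnfs : List PTm → List PTm
    ηnfs []       = []
    ηnfs (p ∷ ps) = ηnf p ∷ ηnfs ps

  ηlam-Nf : ∀ T q → Nf q → Nf (ηlam T q)
  ηlam-Nf T q nf with etaView q
  ... | redex r _ _ nf⇒ = nf⇒ nf
  ... | noRedex ¬η      = plam nf ¬η

  ηlam-Wf : ∀ {k} T q → Wf (suc k) q → Wf k (ηlam T q)
  ηlam-Wf T q wf with etaView q
  ... | redex r _ wf⇒ _ = wf⇒ wf
  ... | noRedex _       = plam wf

  mutual
    ηnf-Nf : ∀ p → Nf (ηnf p)
    ηnf-Nf (plam T p)   = ηlam-Nf T (ηnf p) (ηnf-Nf p)
    ηnf-Nf (pcon f ps)  = pcon (ηnfs-Nf ps)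
    ηnf-Nf (pbv i)      = pbv
    ηnf-Nf (pfv X T is) = pfv

    ηnfs-Nf : ∀ ps → All Nf (ηnfs ps)
    ηnfs-Nf []       = []
    ηnfs-Nf (p ∷ ps) = ηnf-Nf p ∷ ηnfs-Nf ps

  mutual
    ηnf-Wf : ∀ {k} p → Wf k p → Wf k (ηnf p)
    ηnf-Wf (plam T p)   (plam wf)  = ηlam-Wf T (ηnf p) (ηnf-Wf p wf)
    ηnf-Wf (pcon f ps)  (pcon wfs) = pcon (ηnfs-Wf ps wfs)
    ηnf-Wf (pbv i)      wf         = wf
    ηnf-Wf (pfv X T is) wf         = wf

    ηnfs-Wf : ∀ {k} ps → All (Wf k) ps → All (Wf k) (ηnfs ps)
    ηnfs-Wf []       []         = []
    ηnfs-Wf (p ∷ ps) (wf ∷ wfs) = ηnf-Wf p wf ∷ ηnfs-Wf ps wfs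

  lam-⟶* : ∀ {T t t′} → t ⟶* t′ → lam T t ⟶* lam T t′
  lam-⟶* = gmap _ lamc

  app-⟶* : ∀ {t t′ u u′} → t ⟶* t′ → u ⟶* u′ → app t u ⟶* app t′ u′
  app-⟶* t⟶*t′ u⟶*u′ = gmap _ appl t⟶*t′ ◅◅ gmap _ appr u⟶*u′

  ηlam-⟶* : ∀ T q → lam T (embed q) ⟶* embed (ηlam T q)
  ηlam-⟶* T q with etaView q
  ... | redex r e _ _ = subst (λ t → lam T t ⟶* embed r) (sym e) (η ◅ ε)
  ... | noRedex _     = ε

  mutual
    ηnf-⟶* : ∀ p → embed p ⟶* embed (ηnf p)
    ηnf-⟶* (plam T p)   = lam-⟶* (ηnf-⟶* p) ◅◅ ηlam-⟶* T (ηnf p)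
    ηnf-⟶* (pcon f ps)  = ηnfs-⟶* ps ε
    ηnf-⟶* (pbv i)      = ε
    ηnf-⟶* (pfv X T is) = ε

    ηnfs-⟶* : ∀ ps {h h′} → h ⟶* h′ → apps h (embeds ps) ⟶* apps h′ (embeds (ηnfs ps))
    ηnfs-⟶* []       h⟶*h′ = h⟶*h′
    ηnfs-⟶* (p ∷ ps) h⟶*h′ = ηnfs-⟶* ps (app-⟶* h⟶*h′ (ηnf-⟶* p))

  NotLam : Tm → Set
  NotLam (lam _ _) = ⊥
  NotLam _         = ⊤

  lam-⟶⁻ : ∀ {T b t′} → lam T b ⟶ t′ →
           (∃[ t ] b ≡ app (rename suc t) (bv 0)) ⊎ (∃[ b′ ] b ⟶ b′)
  lam-⟶⁻ η        = inj₁ (_ , refl)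
  lam-⟶⁻ (lamc r) = inj₂ (_ , r)

  apps-βηNormal : ∀ {h} us → NotLam h → βηNormal h → All βηNormal us → βηNormal (apps h us)
  apps-βηNormal []       _ h-nf [] = h-nf
  apps-βηNormal (u ∷ us) h≢λ h-nf (u-nf ∷ us-nf) = apps-βηNormal us tt app-nf us-nf
    where
    app-nf : βηNormal (app _ u)
    app-nf _ β        = h≢λ
    app-nf _ (appl r) = h-nf _ r
    app-nf _ (appr r) = u-nf _ r

  mutual
    Nf⇒βηNormal : ∀ p → Nf p → βηNormal (embed p)
    Nf⇒βηNormal (plam T p)   (plam nf ¬η) _ r with lam-⟶⁻ r
    ... | inj₁ (t , e)  = ¬Occurs-thin 0 t (¬η _ e)
    ... | inj₂ (_ , r′) = Nf⇒βηNormal p nf _ r′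
    Nf⇒βηNormal (pcon f ps)  (pcon nfs)   =
      apps-βηNormal (embeds ps) tt (λ _ ()) (Nfs⇒βηNormal ps nfs)
    Nf⇒βηNormal (pbv i)      pbv          = λ _ ()
    Nf⇒βηNormal (pfv X T is) pfv          = apps-βηNormal (map bv is) tt (λ _ ()) (bvs-nf is)
      where
      bvs-nf : ∀ is → All βηNormal (map bv is)
      bvs-nf []       = []
      bvs-nf (i ∷ is) = (λ _ ()) ∷ bvs-nf is

    Nfs⇒βηNormal : ∀ ps → All Nf ps → All βηNormal (embeds ps)
    Nfs⇒βηNormal []       []         = []
    Nfs⇒βηNormal (p ∷ ps) (nf ∷ nfs) = Nf⇒βηNormal p nf ∷ Nfs⇒βηNormal ps nfs

  apps-PatCond : ∀ {k h} us → ¬ IsFlexHead h → PatCond k h → All (PatCond k) us →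
                 PatCond k (apps h us)
  apps-PatCond []       _   ph []         = ph
  apps-PatCond (u ∷ us) ¬fh ph (pu ∷ pus) = apps-PatCond us ¬fh (appP ¬fh ph pu) pus

  mutual
    Wf⇒PatCond : ∀ {k} p → Wf k p → PatCond k (embed p)
    Wf⇒PatCond (plam T p)   (plam wf)   = lamP (Wf⇒PatCond p wf)
    Wf⇒PatCond (pcon f ps)  (pcon wfs)  = apps-PatCond (embeds ps) (λ ()) conP (Wfs⇒PatCond ps wfs)
    Wf⇒PatCond (pbv i)      pbv         = bvP
    Wf⇒PatCond (pfv X T is) (pfv is< u) = flexP is is< u

    Wfs⇒PatCond : ∀ {k} ps → All (Wf k) ps → All (PatCond k) (embeds ps)
    Wfs⇒PatCond []       []         = []
    Wfs⇒PatCond (p ∷ ps) (wf ∷ wfs) = Wf⇒PatCond p wf ∷ Wfs⇒PatCond ps wfs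

  Wf⇒IsPattern : ∀ p → Wf 0 p → IsPattern (embed p)
  Wf⇒IsPattern p wf =
    embed (ηnf p) , ηnf-⟶* p , Nf⇒βηNormal (ηnf p) (ηnf-Nf p) , Wf⇒PatCond (ηnf p) (ηnf-Wf p wf)

  swap-left : ∀ a b → swapAtom (a , b) a ≡ b
  swap-left a b with a ≟At a
  ... | yes _   = refl
  ... | no a≢a = ⊥-elim (a≢a refl)

  swap-right : ∀ a b → swapAtom (a , b) b ≡ a
  swap-right a b with b ≟At a
  ... | yes b≡a = b≡a
  ... | no _ with b ≟At b
  ...   | yes _   = refl
  ...   | no b≢b = ⊥-elim (b≢b refl)

  swap-fixed : ∀ {a b c} → c ≢ a → c ≢ b → swapAtom (a , b) c ≡ c
  swap-fixed {a} {b} {c} c≢a c≢b with c ≟At a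
  ... | yes c≡a = ⊥-elim (c≢a c≡a)
  ... | no _ with c ≟At b
  ...   | yes c≡b = ⊥-elim (c≢b c≡b)
  ...   | no _    = refl

  data SwapView (a b : Atom) : Atom → Set where
    left  : SwapView a b a
    right : SwapView a b b
    fixed : ∀ {c} → c ≢ a → c ≢ b → SwapView a b c

  swapView : ∀ a b c → SwapView a b c
  swapView a b c with c ≟At a | c ≟At b
  ... | yes refl | _        = left
  ... | no _     | yes refl = right
  ... | no c≢a   | no c≢b   = fixed c≢a c≢b

  swap-involutive : ∀ s c → swapAtom s (swapAtom s c) ≡ c
  swap-involutive (a , b) c with swapView a b c
  ... | left          = trans (cong (swapAtom (a , b)) (swap-left a b)) (swap-right a b)
  ... | right         = trans (cong (swapAtom (a , b)) (swap-right a b)) (swap-left a b)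
  ... | fixed c≢a c≢b = trans (cong (swapAtom (a , b)) (swap-fixed c≢a c≢b)) (swap-fixed c≢a c≢b)

  ·-injective : ∀ π {c d} → π · c ≡ π · d → c ≡ d
  ·-injective []      e = e
  ·-injective (s ∷ π) {c} {d} e = ·-injective π (begin
    π · c                         ≡⟨ sym (swap-involutive s (π · c)) ⟩
    swapAtom s ((s ∷ π) · c)      ≡⟨ cong (swapAtom s) e ⟩
    swapAtom s ((s ∷ π) · d)      ≡⟨ swap-involutive s (π · d) ⟩
    π · d                         ∎)
    where open ≡-Reasoning

  sort-swap : ∀ a b c → sort a ≡ sort b → sort (swapAtom (a , b) c) ≡ sort c
  sort-swap a b c eq with swapView a b c
  ... | left          = trans (cong sort (swap-left a b)) (sym eq)
  ... | right         = trans (cong sort (swap-right a b)) eq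
  ... | fixed c≢a c≢b = cong sort (swap-fixed c≢a c≢b)

  sort-· : ∀ π c → PermOK π → sort (π · c) ≡ sort c
  sort-· []            c []         = refl
  sort-· ((a , b) ∷ π) c (eq ∷ ok) = trans (sort-swap a b (π · c) eq) (sort-· π c ok)

  permAtoms : Perm → List Atom
  permAtoms = concatMap (λ s → proj₁ s ∷ proj₂ s ∷ [])

  ·-∈ : ∀ π {c sc} → permAtoms π ⊆ sc → c ∈ sc → π · c ∈ sc
  ·-∈ []            π⊆ c∈ = c∈
  ·-∈ ((a , b) ∷ π) {c} π⊆ c∈ with swapView a b (π · c)
  ... | left          = subst (_∈ _) (sym (swap-left a b)) (π⊆ (there (here refl)))
  ... | right         = subst (_∈ _) (sym (swap-right a b)) (π⊆ (here refl))
  ... | fixed c≢a c≢b =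
    subst (_∈ _) (sym (swap-fixed c≢a c≢b)) (·-∈ π (λ x∈ → π⊆ (there (there x∈))) c∈)

  ty : Atom → Ty
  ty a = ν (sort a)

  idx-< : ∀ {sc a} → a ∈ sc → idx sc a < length sc
  idx-< {b ∷ sc} {a} a∈ with a ≟At b
  idx-< {b ∷ sc} _          | yes _   = s≤s z≤n
  idx-< {b ∷ sc} (here a≡b) | no a≢b  = ⊥-elim (a≢b a≡b)
  idx-< {b ∷ sc} (there a∈) | no _    = s≤s (idx-< a∈)

  idx-∋ : ∀ {sc a} → a ∈ sc → map ty sc ∋ idx sc a ∶ ty a
  idx-∋ {b ∷ sc} {a} a∈ with a ≟At b
  idx-∋ {b ∷ sc} _          | yes refl = here
  idx-∋ {b ∷ sc} (here a≡b) | no a≢b   = ⊥-elim (a≢b a≡b)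
  idx-∋ {b ∷ sc} (there a∈) | no _     = there (idx-∋ a∈)

  idx-injective : ∀ {sc a a′} → a ∈ sc → a′ ∈ sc → idx sc a ≡ idx sc a′ → a ≡ a′
  idx-injective {b ∷ sc} {a} {a′} a∈ a′∈ e with a ≟At b | a′ ≟At b
  ... | yes a≡b | yes a′≡b = trans a≡b (sym a′≡b)
  idx-injective (here a≡b) _ e           | no a≢b | _       = ⊥-elim (a≢b a≡b)
  idx-injective _ (here a′≡b) e          | _      | no a′≢b = ⊥-elim (a′≢b a′≡b)
  idx-injective (there a∈) (there a′∈) e | no _   | no _    = idx-injective a∈ a′∈ (suc-injective e)

  mutual
    trP : List Atom → List Atom → NTm → PTm
    trP as sc (fun f ts) = pcon f (trPs as sc ts)
    trP as sc (atom a)   = pbv (idx sc a)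
    trP as sc (abst a t) = plam (ty a) (trP as (a ∷ sc) t)
    trP as sc (susp π X) = pfv X (typeX as X) (map (λ b → idx sc (π · b)) as)

    trPs : List Atom → List Atom → List NTm → List PTm
    trPs as sc []       = []
    trPs as sc (t ∷ ts) = trP as sc t ∷ trPs as sc ts

  mutual
    embed-trP : ∀ as sc t → embed (trP as sc t) ≡ tr as sc t
    embed-trP as sc (fun f ts) = cong (apps (con f)) (embeds-trPs as sc ts)
    embed-trP as sc (atom a)   = refl
    embed-trP as sc (abst a t) = cong (lam (ty a)) (embed-trP as (a ∷ sc) t)
    embed-trP as sc (susp π X) = cong (apps (fv X (typeX as X))) (sym (List.map-∘ as))

    embeds-trPs : ∀ as sc ts → embeds (trPs as sc ts) ≡ trs as sc ts
    embeds-trPs as sc []       = refl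
    embeds-trPs as sc (t ∷ ts) = cong₂ _∷_ (embed-trP as sc t) (embeds-trPs as sc ts)

  mutual
    trP-Wf : ∀ {as sc} t → atomsOf t ⊆ sc → as ⊆ sc → Unique as → Wf (length sc) (trP as sc t)
    trP-Wf (fun f ts) t⊆ as⊆ u = pcon (trPs-Wf ts t⊆ as⊆ u)
    trP-Wf (atom a)   t⊆ as⊆ u = pbv
    trP-Wf (abst a t) t⊆ as⊆ u =
      plam (trP-Wf t (λ x∈ → there (t⊆ (there x∈))) (λ x∈ → there (as⊆ x∈)) u)
    trP-Wf {as} {sc} (susp π X) π⊆ as⊆ u =
      pfv (All.map⁺ (All.tabulate λ b∈ → idx-< (π·∈ b∈)))
          (Unique-map⁺-on _ (λ b∈ c∈ e → ·-injective π (idx-injective (π·∈ b∈) (π·∈ c∈) e)) u)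
      where
      π·∈ : ∀ {b} → b ∈ as → π · b ∈ sc
      π·∈ b∈ = ·-∈ π π⊆ (as⊆ b∈)

    trPs-Wf : ∀ {as sc} ts → atomsOfs ts ⊆ sc → as ⊆ sc → Unique as →
              All (Wf (length sc)) (trPs as sc ts)
    trPs-Wf []       ts⊆ as⊆ u = []
    trPs-Wf (t ∷ ts) ts⊆ as⊆ u =
      trP-Wf t (λ x∈ → ts⊆ (∈-++⁺ˡ x∈)) as⊆ u
      ∷ trPs-Wf ts (λ x∈ → ts⊆ (∈-++⁺ʳ (atomsOf t) x∈)) as⊆ u

  lamsP : List Atom → PTm → PTm
  lamsP as p = foldr (λ a → plam (ty a)) p as

  embed-lamsP : ∀ as p → embed (lamsP as p) ≡ lams as (embed p)
  embed-lamsP []       p = refl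
  embed-lamsP (a ∷ as) p = cong (lam (ty a)) (embed-lamsP as p)

  lamsP-Wf : ∀ as {k p} → Wf (k + length as) p → Wf k (lamsP as p)
  lamsP-Wf []       {k} {p} wf = subst (λ n → Wf n p) (+-identityʳ k) wf
  lamsP-Wf (a ∷ as) {k} {p} wf = plam (lamsP-Wf as (subst (λ n → Wf n p) (+-suc k (length as)) wf))

  trTop-IsPattern : ∀ {as} t → atomsOf t ⊆ as → Unique as → IsPattern (trTop as t)
  trTop-IsPattern {as} t t⊆ u =
    subst IsPattern (trans (embed-lamsP as body) (cong (lams as) (embed-trP as (reverse as) t)))
      (Wf⇒IsPattern (lamsP as body) (lamsP-Wf as (subst (λ n → Wf n body) (List.length-reverse as)
        (trP-Wf t (λ x∈ → Any.reverse⁺ (t⊆ x∈)) Any.reverse⁺ u))))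
    where
    body : PTm
    body = trP as (reverse as) t

  Args⊢ : ∀ {A : Set} → List Ty → (A → Ty) → List Tm → List A → Set
  Args⊢ Γ F = Pointwise (λ u x → Γ ⊢ u ∶ F x)

  apps-⊢ : ∀ {A : Set} {Γ F R h us} {xs : List A} →
           Γ ⊢ h ∶ foldr (λ x T → F x ⇒ T) R xs → Args⊢ Γ F us xs → Γ ⊢ apps h us ∶ R
  apps-⊢ ⊢h []           = ⊢h
  apps-⊢ ⊢h (⊢u ∷ ⊢us) = apps-⊢ (appT ⊢h ⊢u) ⊢us

  susp-args-⊢ : ∀ π {sc} bs → PermOK π → permAtoms π ⊆ sc → bs ⊆ sc →
                Args⊢ (map ty sc) ty (map (λ b → bv (idx sc (π · b))) bs) bs
  susp-args-⊢ π []       ok π⊆ bs⊆ = []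
  susp-args-⊢ π {sc} (b ∷ bs) ok π⊆ bs⊆ =
    bvT (subst (λ A → map ty sc ∋ idx sc (π · b) ∶ ν A) (sort-· π b ok)
               (idx-∋ (·-∈ π π⊆ (bs⊆ (here refl)))))
    ∷ susp-args-⊢ π bs ok π⊆ (λ x∈ → bs⊆ (there x∈))

  mutual
    tr-⊢ : ∀ {as sc τ} t → HasSort t τ → atomsOf t ⊆ sc → as ⊆ sc →
           map ty sc ⊢ tr as sc t ∶ ⟦ τ ⟧s
    tr-⊢ (fun f ts) (funS ⊢ts) t⊆ as⊆ = apps-⊢ conT (trs-⊢ ts ⊢ts t⊆ as⊆)
    tr-⊢ (atom a)   atomS       t⊆ as⊆ = bvT (idx-∋ (t⊆ (here refl)))
    tr-⊢ (abst a t) (abstS ⊢t)  t⊆ as⊆ =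
      lamT (tr-⊢ t ⊢t (λ x∈ → there (t⊆ (there x∈))) (λ x∈ → there (as⊆ x∈)))
    tr-⊢ {as} (susp π X) (suspS ok) π⊆ as⊆ = apps-⊢ fvT (susp-args-⊢ π as ok π⊆ as⊆)

    trs-⊢ : ∀ {as sc τs} ts → HasSorts ts τs → atomsOfs ts ⊆ sc → as ⊆ sc →
            Args⊢ (map ty sc) ⟦_⟧s (trs as sc ts) τs
    trs-⊢ []       []           ts⊆ as⊆ = []
    trs-⊢ (t ∷ ts) (⊢t ∷ ⊢ts) ts⊆ as⊆ =
      tr-⊢ t ⊢t (λ x∈ → ts⊆ (∈-++⁺ˡ x∈)) as⊆
      ∷ trs-⊢ ts ⊢ts (λ x∈ → ts⊆ (∈-++⁺ʳ (atomsOf t) x∈)) as⊆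

  lams-⊢ : ∀ as {Γ b U} → (map ty (reverse as) ++ Γ) ⊢ b ∶ U →
           Γ ⊢ lams as b ∶ foldr (λ a T → ty a ⇒ T) U as
  lams-⊢ []       ⊢b = ⊢b
  lams-⊢ (a ∷ as) {Γ} {b} {U} ⊢b = lamT (lams-⊢ as (subst (λ Δ → Δ ⊢ b ∶ U) ctx ⊢b))
    where
    open ≡-Reasoning
    ctx : map ty (reverse (a ∷ as)) ++ Γ ≡ map ty (reverse as) ++ ty a ∷ Γ
    ctx = begin
      map ty (reverse (a ∷ as)) ++ Γ      ≡⟨ cong (λ xs → map ty xs ++ Γ) (List.unfold-reverse a as) ⟩
      map ty (reverse as ∷ʳ a) ++ Γ       ≡⟨ cong (_++ Γ) (List.map-++ ty (reverse as) (a ∷ [])) ⟩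
      (map ty (reverse as) ∷ʳ ty a) ++ Γ  ≡⟨ List.++-assoc (map ty (reverse as)) (ty a ∷ []) Γ ⟩
      map ty (reverse as) ++ ty a ∷ Γ     ∎

  trTop-⊢ : ∀ {as τ} t → HasSort t τ → atomsOf t ⊆ as →
            [] ⊢ trTop as t ∶ foldr (λ a T → ty a ⇒ T) ⟦ τ ⟧s as
  trTop-⊢ {as} {τ} t ⊢t t⊆ = lams-⊢ as
    (subst (λ Γ → Γ ⊢ tr as (reverse as) t ∶ ⟦ τ ⟧s) (sym (List.++-identityʳ (map ty (reverse as))))
      (tr-⊢ t ⊢t (λ x∈ → Any.reverse⁺ (t⊆ x∈)) Any.reverse⁺))

  ⟦⟧P-HOPatternProblem : ∀ {as} P → WellSortedProblem P → Unique as → atomsP P ⊆ as →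
                         HOPatternProblem (⟦ P ⟧P as)
  ⟦⟧P-HOPatternProblem []                 []                    u P⊆ = []
  ⟦⟧P-HOPatternProblem {as} ((l , r) ∷ P) ((τ , ⊢l , ⊢r) ∷ ⊢P) u P⊆ =
    (_ , trTop-⊢ l ⊢l l⊆ , trTop-⊢ r ⊢r r⊆ , trTop-IsPattern l l⊆ u , trTop-IsPattern r r⊆ u)
    ∷ ⟦⟧P-HOPatternProblem P ⊢P u (λ x∈ → P⊆ (∈-++⁺ʳ (atomsOf l ++ atomsOf r) x∈))
    where
    l⊆ : atomsOf l ⊆ as
    l⊆ x∈ = P⊆ (∈-++⁺ˡ (∈-++⁺ˡ x∈))
    r⊆ : atomsOf r ⊆ as
    r⊆ x∈ = P⊆ (∈-++⁺ˡ (∈-++⁺ʳ (atomsOf l) x∈))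

  argsCost : Perm → List Atom → ℕ
  argsCost π bs = suc (length bs * suc (suc (length π)))

  mutual
    cost : List Atom → NTm → ℕ
    cost as (fun f ts) = suc (costs as ts)
    cost as (atom a)   = 1
    cost as (abst a t) = suc (cost as t)
    cost as (susp π X) = suc (suc (length as) + argsCost π as)

    costs : List Atom → List NTm → ℕ
    costs as []       = 1
    costs as (t ∷ ts) = suc (cost as t + costs as ts)

  eqsCost : List Atom → Problem → ℕ
  eqsCost as []            = 1
  eqsCost as ((l , r) ∷ P) =
    suc (cost as l + cost as r + eqsCost as P + suc (length as) + suc (length as))

  permC-≡ : ∀ π c → permC π c ≡ (π · c , suc (length π))
  permC-≡ []      c = refl
  permC-≡ (s ∷ π) c rewrite permC-≡ π c = refl

  argsC-≡ : ∀ sc π bs → argsC sc π bs ≡ (map (λ b → bv (idx sc (π · b))) bs , argsCost π bs)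
  argsC-≡ sc π []       = refl
  argsC-≡ sc π (b ∷ bs) rewrite permC-≡ π b | argsC-≡ sc π bs =
    cong (map (λ b → bv (idx sc (π · b))) (b ∷ bs) ,_)
         (cong (suc ∘ suc) (+-suc (length π) (length bs * suc (suc (length π)))))

  mutual
    trC-≡ : ∀ as sc t → trC as sc t ≡ (tr as sc t , cost as t)
    trC-≡ as sc (fun f ts) rewrite trsC-≡ as sc ts       = refl
    trC-≡ as sc (atom a)                                  = refl
    trC-≡ as sc (abst a t) rewrite trC-≡ as (a ∷ sc) t    = refl
    trC-≡ as sc (susp π X) rewrite argsC-≡ sc π as        = refl

    trsC-≡ : ∀ as sc ts → trsC as sc ts ≡ (trs as sc ts , costs as ts)
    trsC-≡ as sc []       = refl
    trsC-≡ as sc (t ∷ ts) rewrite trC-≡ as sc t | trsC-≡ as sc ts = refl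

  eqsC-≡ : ∀ as P → eqsC as (reverse as) P ≡ (⟦ P ⟧P as , eqsCost as P)
  eqsC-≡ as []            = refl
  eqsC-≡ as ((l , r) ∷ P)
    rewrite trC-≡ as (reverse as) l | trC-≡ as (reverse as) r | eqsC-≡ as P = refl

  translateC-≡ : ∀ P as → translateC P as ≡ (⟦ P ⟧P as , suc (length as) + eqsCost as P)
  translateC-≡ P as rewrite eqsC-≡ as P = refl

  tsize-apps-bvs : ∀ π (g : Atom → ℕ) h bs →
                   tsize (apps h (map (λ b → bv (g b)) bs)) ≤ tsize h + argsCost π bs
  tsize-apps-bvs π g h []       = m≤m+n (tsize h) 1
  tsize-apps-bvs π g h (b ∷ bs) = begin
    tsize (apps (app h (bv (g b))) (map (λ b → bv (g b)) bs))
      ≤⟨ tsize-apps-bvs π g (app h (bv (g b))) bs ⟩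
    suc (tsize h + 1) + argsCost π bs
      ≤⟨ m+d≡n⇒m≤n (length π) (lem (tsize h) (length π) (length bs)) ⟩
    tsize h + argsCost π (b ∷ bs)
      ∎
    where
    open ≤-Reasoning
    lem : ∀ a L l → suc (a + 1) + suc (l * suc (suc L)) + L ≡ a + suc (suc l * suc (suc L))
    lem = solve-∀

  mutual
    tsize-tr≤cost : ∀ as sc t → tsize (tr as sc t) ≤ cost as t
    tsize-tr≤cost as sc (fun f ts) = tsize-apps-trs≤ as sc ts (con f)
    tsize-tr≤cost as sc (atom a)   = s≤s z≤n
    tsize-tr≤cost as sc (abst a t) = s≤s (tsize-tr≤cost as (a ∷ sc) t)
    tsize-tr≤cost as sc (susp π X) =
      ≤-trans (tsize-apps-bvs π (λ b → idx sc (π · b)) (fv X (typeX as X)) as)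
              (s≤s (m≤n+m _ (suc (length as))))

    tsize-apps-trs≤ : ∀ as sc ts h → tsize (apps h (trs as sc ts)) ≤ tsize h + costs as ts
    tsize-apps-trs≤ as sc []       h = m≤m+n (tsize h) 1
    tsize-apps-trs≤ as sc (t ∷ ts) h = begin
      tsize (apps (app h (tr as sc t)) (trs as sc ts))
        ≤⟨ tsize-apps-trs≤ as sc ts (app h (tr as sc t)) ⟩
      suc (tsize h + tsize (tr as sc t)) + costs as ts
        ≤⟨ +-monoˡ-≤ (costs as ts) (s≤s (+-monoʳ-≤ (tsize h) (tsize-tr≤cost as sc t))) ⟩
      suc (tsize h + cost as t) + costs as ts
        ≡⟨ lem (tsize h) (cost as t) (costs as ts) ⟩
      tsize h + costs as (t ∷ ts)
        ∎
      where
      open ≤-Reasoning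
      lem : ∀ a b c → suc (a + b) + c ≡ a + suc (b + c)
      lem = solve-∀

  tsize-lams : ∀ as b → tsize (lams as b) ≡ length as + tsize b
  tsize-lams []       b = refl
  tsize-lams (a ∷ as) b = cong suc (tsize-lams as b)

  qsize≤eqsCost : ∀ as P → qsize (⟦ P ⟧P as) ≤ eqsCost as P
  qsize≤eqsCost as []            = z≤n
  qsize≤eqsCost as ((l , r) ∷ P) = begin
    tsize (trTop as l) + tsize (trTop as r) + qsize (⟦ P ⟧P as)
      ≤⟨ +-mono-≤ (+-mono-≤ (trTop≤cost l) (trTop≤cost r)) (qsize≤eqsCost as P) ⟩
    (m + cost as l) + (m + cost as r) + eqsCost as P
      ≤⟨ m+d≡n⇒m≤n 3 (lem m (cost as l) (cost as r) (eqsCost as P)) ⟩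
    eqsCost as ((l , r) ∷ P)
      ∎
    where
    open ≤-Reasoning
    m : ℕ
    m = length as
    trTop≤cost : ∀ t → tsize (trTop as t) ≤ m + cost as t
    trTop≤cost t rewrite tsize-lams as (tr as (reverse as) t) =
      +-monoʳ-≤ m (tsize-tr≤cost as (reverse as) t)
    lem : ∀ m a b c → m + a + (m + b) + c + 3 ≡ suc (a + b + c + suc m + suc m)
    lem = solve-∀

  mutual
    cost-bound : ∀ as t → length as + 2 + cost as t ≤ 5 * suc (length as) * nsize t
    cost-bound as (fun f ts) = begin
      m + 2 + suc (costs as ts)        ≤⟨ +-monoʳ-≤ (m + 2) (s≤s (costs-bound as ts)) ⟩
      m + 2 + suc (suc (w * n))        ≤⟨ m+d≡n⇒m≤n (1 + 4 * m) (lem m n) ⟩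
      w * suc n                        ∎
      where
      open ≤-Reasoning
      m n w : ℕ
      m = length as
      n = nsizes ts
      w = 5 * suc m
      lem : ∀ m n → m + 2 + suc (suc (5 * suc m * n)) + (1 + 4 * m) ≡ 5 * suc m * suc n
      lem = solve-∀
    cost-bound as (atom a) = m+d≡n⇒m≤n (4 * length as + 2) (lem (length as))
      where
      lem : ∀ m → m + 2 + 1 + (4 * m + 2) ≡ 5 * suc m * 1
      lem = solve-∀
    cost-bound as (abst a t) = begin
      m + 2 + suc (cost as t)          ≡⟨ +-suc (m + 2) (cost as t) ⟩
      suc (m + 2 + cost as t)          ≤⟨ s≤s (cost-bound as t) ⟩
      suc (w * n)                      ≤⟨ m+d≡n⇒m≤n (9 + 10 * m) (lem m n) ⟩
      w * suc (suc n)                  ∎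
      where
      open ≤-Reasoning
      m n w : ℕ
      m = length as
      n = nsize t
      w = 5 * suc m
      lem : ∀ m n → suc (5 * suc m * n) + (9 + 10 * m) ≡ 5 * suc m * suc (suc n)
      lem = solve-∀
    cost-bound as (susp π X) =
      m+d≡n⇒m≤n (m + 5 * L + 4 * (m * L)) (lem m L)
      where
      m L : ℕ
      m = length as
      L = length π
      lem : ∀ m L → m + 2 + suc (suc m + suc (m * suc (suc L))) + (m + 5 * L + 4 * (m * L))
                    ≡ 5 * suc m * suc L
      lem = solve-∀

    costs-bound : ∀ as ts → costs as ts ≤ suc (5 * suc (length as) * nsizes ts)
    costs-bound as []       = s≤s z≤n
    costs-bound as (t ∷ ts) = begin
      suc (cost as t + costs as ts)     ≤⟨ s≤s (+-monoʳ-≤ (cost as t) (costs-bound as ts)) ⟩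
      suc (cost as t + suc (w * n′))    ≤⟨ m+d≡n⇒m≤n m (lem m (cost as t) (w * n′)) ⟩
      m + 2 + cost as t + w * n′        ≤⟨ +-monoˡ-≤ (w * n′) (cost-bound as t) ⟩
      w * n + w * n′                    ≡⟨ sym (*-distribˡ-+ w n n′) ⟩
      w * (n + n′)                      ≤⟨ n≤1+n _ ⟩
      suc (w * (n + n′))                ∎
      where
      open ≤-Reasoning
      m n n′ w : ℕ
      m = length as
      n = nsize t
      n′ = nsizes ts
      w = 5 * suc m
      lem : ∀ m c x → suc (c + suc x) + m ≡ m + 2 + c + x
      lem = solve-∀

  eqsCost-bound : ∀ as P → eqsCost as P ≤ suc (5 * suc (length as) * psize P)
  eqsCost-bound as []            = s≤s z≤n
  eqsCost-bound as ((l , r) ∷ P) = begin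
    suc (cost as l + cost as r + eqsCost as P + suc m + suc m)
      ≤⟨ m+d≡n⇒m≤n 1 (lem₁ m (cost as l) (cost as r) (eqsCost as P)) ⟩
    (m + 2 + cost as l) + (m + 2 + cost as r) + eqsCost as P
      ≤⟨ +-mono-≤ (+-mono-≤ (cost-bound as l) (cost-bound as r)) (eqsCost-bound as P) ⟩
    w * nsize l + w * nsize r + suc (w * psize P)
      ≡⟨ lem₂ m (nsize l) (nsize r) (psize P) ⟩
    suc (w * psize ((l , r) ∷ P))
      ∎
    where
    open ≤-Reasoning
    m w : ℕ
    m = length as
    w = 5 * suc m
    lem₁ : ∀ m a b c → suc (a + b + c + suc m + suc m) + 1 ≡ (m + 2 + a) + (m + 2 + b) + c
    lem₁ = solve-∀
    lem₂ : ∀ m a b c → 5 * suc m * a + 5 * suc m * b + suc (5 * suc m * c)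
                     ≡ suc (5 * suc m * (a + b + c))
    lem₂ = solve-∀

  mutual
    length-atomsOf : ∀ t → length (atomsOf t) ≤ 2 * nsize t
    length-atomsOf (fun f ts) = ≤-trans (length-atomsOfs ts) (*-monoʳ-≤ 2 (n≤1+n _))
    length-atomsOf (atom a)   = s≤s z≤n
    length-atomsOf (abst a t) = ≤-trans (s≤s (length-atomsOf t)) (m+d≡n⇒m≤n 3 (lem (nsize t)))
      where
      lem : ∀ n → suc (2 * n) + 3 ≡ 2 * suc (suc n)
      lem = solve-∀
    length-atomsOf (susp π X) =
      ≤-trans (≤-reflexive (length-permAtoms π)) (m+d≡n⇒m≤n 2 (lem (length π)))
      where
      length-permAtoms : ∀ π → length (permAtoms π) ≡ length π * 2
      length-permAtoms []      = refl
      length-permAtoms (s ∷ π) = cong (suc ∘ suc) (length-permAtoms π)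
      lem : ∀ L → L * 2 + 2 ≡ 2 * suc L
      lem = solve-∀

    length-atomsOfs : ∀ ts → length (atomsOfs ts) ≤ 2 * nsizes ts
    length-atomsOfs []       = z≤n
    length-atomsOfs (t ∷ ts) = begin
      length (atomsOf t ++ atomsOfs ts)           ≡⟨ List.length-++ (atomsOf t) ⟩
      length (atomsOf t) + length (atomsOfs ts)   ≤⟨ +-mono-≤ (length-atomsOf t) (length-atomsOfs ts) ⟩
      2 * nsize t + 2 * nsizes ts                 ≡⟨ sym (*-distribˡ-+ 2 (nsize t) (nsizes ts)) ⟩
      2 * (nsize t + nsizes ts)                   ∎
      where open ≤-Reasoning

  length-atomsP : ∀ P → length (atomsP P) ≤ 2 * psize P
  length-atomsP []            = z≤n
  length-atomsP ((l , r) ∷ P) = begin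
    length ((atomsOf l ++ atomsOf r) ++ atomsP P)
      ≡⟨ List.length-++ (atomsOf l ++ atomsOf r) ⟩
    length (atomsOf l ++ atomsOf r) + length (atomsP P)
      ≡⟨ cong (_+ length (atomsP P)) (List.length-++ (atomsOf l)) ⟩
    length (atomsOf l) + length (atomsOf r) + length (atomsP P)
      ≤⟨ +-mono-≤ (+-mono-≤ (length-atomsOf l) (length-atomsOf r)) (length-atomsP P) ⟩
    2 * nsize l + 2 * nsize r + 2 * psize P
      ≡⟨ lem (nsize l) (nsize r) (psize P) ⟩
    2 * psize ((l , r) ∷ P)
      ∎
    where
    open ≤-Reasoning
    lem : ∀ a b c → 2 * a + 2 * b + 2 * c ≡ 2 * (a + b + c)
    lem = solve-∀

  length≤2*psize : ∀ {as} P → Unique as → as ⊆ atomsP P → length as ≤ 2 * psize P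
  length≤2*psize P u as⊆ = ≤-trans (Unique-⊆⇒length-≤ u as⊆) (length-atomsP P)

  qsize-⟦⟧P-bound : ∀ as P → qsize (⟦ P ⟧P as) ≤ suc (length as) + suc (5 * suc (length as) * psize P)
  qsize-⟦⟧P-bound as P =
    ≤-trans (≤-trans (qsize≤eqsCost as P) (eqsCost-bound as P)) (m≤n+m _ (suc (length as)))

  translateC-cost-bound : ∀ P as →
    proj₂ (translateC P as) ≤ suc (length as) + suc (5 * suc (length as) * psize P)
  translateC-cost-bound P as =
    ≤-trans (≤-reflexive (cong proj₂ (translateC-≡ P as))) (+-monoʳ-≤ (suc (length as)) (eqsCost-bound as P))

lemma5p7 : (S : Signature) → let open Nominal S in
    ((P : Problem) (as : List Atom) →
    WellSortedProblem P → Unique as → (∀ a → (a ∈ as) ⇔ (a ∈ atomsP P)) →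
    HOPatternProblem (⟦ P ⟧P as))
    × Σ ℕ (λ c → (P : Problem) (as : List Atom) →
    WellSortedProblem P → Unique as → (∀ a → (a ∈ as) ⇔ (a ∈ atomsP P)) →
    (qsize (⟦ P ⟧P as) ≤ c * (psize P * psize P) + c)
    × (proj₁ (translateC P as) ≡ ⟦ P ⟧P as)
    × (proj₂ (translateC P as) ≤ c * (psize P * psize P) + c))
lemma5p7 S =
    (λ P as ⊢P u as⇔P → ⟦⟧P-HOPatternProblem P ⊢P u (λ {a} → Equivalence.from (as⇔P a)))
  , 20
  , λ P as _ u as⇔P →
      let m≤2n = length≤2*psize P u (λ {a} → Equivalence.to (as⇔P a)) in
      quadratic-bound m≤2n (qsize-⟦⟧P-bound as P)
    , cong proj₁ (translateC-≡ P as)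
    , quadratic-bound m≤2n (translateC-cost-bound P as)
  where open Translation S
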